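{- Let $M$ be a simple term of type $A$ containing no existential variables. (1) If $(\Gamma,x{:}C);\Omega;\Delta\vdash M\downarrow A$, then either $\Gamma;\Omega;(\Delta,x{:}C)\vdash M\downarrow A$ or $\Gamma;(\Omega,x{:}C);\Delta\vdash M\downarrow A$. (2) If $(\Gamma,x{:}C);\Omega;\Delta\vdash M\Uparrow A$, then either $\Gamma;\Omega;(\Delta,x{:}C)\vdash M\Uparrow A$ or $\Gamma;(\Omega,x{:}C);\Delta\vdash M\Uparrow A$.
   Context: Strict $\lambda$-calculus over a signature $\Sigma$: labels $k\in\{1,0,u\}$, types $A::=a\mid A_1\to^kA_2$, terms $c\mid x\mid\lambda x^k{:}A.M\mid M_1M_2^k$. Contexts: finite sets of declarations with distinct variables; commas denote disjoint unions. Canonical ($\Uparrow$) and atomic ($\downarrow$) forms $\Gamma;\Omega;\Delta\vdash M\Uparrow A$, $\Gamma;\Omega;\Delta\vdash M\downarrow A$ ($\Gamma$ unrestricted, $\Omega$ irrelevant, $\Delta$ strict; disjoint): $c{:}A\in\Sigma$ gives $\Gamma;\Omega;\cdot\vdash c\downarrow A$; $(\Gamma,x{:}A);\Omega;\cdot\vdash x\downarrow A$; $\Gamma;\Omega;x{:}A\vdash x\downarrow A$ (no rule for $\Omega$); $M\downarrow a$ ($a$ atomic) gives $M\Uparrow a$; from $(\Gamma,x{:}A);\Omega;\Delta\vdash M\Uparrow B$ infer $\Gamma;\Omega;\Delta\vdash\lambda x^u{:}A.M\Uparrow A\to^uB$; from $\Gamma;(\Omega,x{:}A);\Delta\vdash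 M\Uparrow B$ infer $\lambda x^0{:}A.M\Uparrow A\to^0B$; from $\Gamma;\Omega;(\Delta,x{:}A)\vdash M\Uparrow B$ infer $\lambda x^1{:}A.M\Uparrow A\to^1B$; from $\Gamma;\Omega;\Delta\vdash M\downarrow A\to^uB$ and $(\Gamma,\Delta);\Omega;\cdot\vdash N\Uparrow A$ infer $\Gamma;\Omega;\Delta\vdash MN^u\downarrow B$; from $\Gamma;\Omega;\Delta\vdash M\downarrow A\to^0B$ and $(\Gamma,\Omega,\Delta);\cdot;\cdot\vdash N\Uparrow A$ infer $\Gamma;\Omega;\Delta\vdash MN^0\downarrow B$; from $(\Gamma,\Delta_N);\Omega;\Delta_M\vdash M\downarrow A\to^1B$ and $(\Gamma,\Delta_M);\Omega;\Delta_N\vdash N\Uparrow A$ infer $\Gamma;\Omega;(\Delta_M,\Delta_N)\vdash MN^1\downarrow B$. Positive types $P::=a\mid N\to^1P$, negative types $N::=a\mid P\to^uN$. Simple terms (without existential variables) are given by the grammar $M::=\lambda x^u{:}P.\,M\mid h\,M_1^1\dots M_n^1$ with $h$ a constant or variable and $n\ge0$ (only undetermined abstractions over positive types and only strict applications). -}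

module Defs where

open import Data.Nat using (ℕ)
open import Data.Product using (_×_; _,_; proj₁)
open import Data.List using (List; []; _∷_; _++_; map)
open import Data.List.Membership.Propositional using (_∈_)
open import Data.List.Relation.Unary.Unique.Propositional using (Unique)
open import Data.List.Relation.Binary.Permutation.Propositional using (_↭_)
open import Relation.Binary.PropositionalEquality using (_≡_)

Var : Set
Var = ℕ

Const : Set
Const = ℕ

Atom : Set
Atom = ℕ

data Label : Set where
  l1 : Label   -- strict
  l0 : Label   -- irrelevant
  lu : Label   -- undetermined (unrestricted)

data Ty : Set where
  atom : Atom → Ty
  arr  : Ty → Label → Ty → Ty

-- Terms  c | x | λx^k:A.M | M₁ M₂^k   (no existential variables in this syntax)
data Tm : Set where
  const : Const → Tm
  var   : Var → Tm
  lam   : Var → Label → Ty → Tm → Tm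
  app   : Tm → Label → Tm → Tm

-- Contexts: lists of declarations, read up to permutation (the judgment is
-- permutation-invariant; disjoint unions are list concatenations, and the only
-- genuine context split (strict application) is taken up to permutation).
Ctx : Set
Ctx = List (Var × Ty)

Sig : Set
Sig = List (Const × Ty)

dom : Ctx → List Var
dom = map proj₁

WF : Ctx → Ctx → Ctx → Set
WF Γ Ω Δ = Unique (dom (Γ ++ Ω ++ Δ))

mutual
  data Pos : Ty → Set where
    pos-atom : ∀ {a} → Pos (atom a)
    pos-arr  : ∀ {N P} → Neg N → Pos P → Pos (arr N l1 P)

  data Neg : Ty → Set where
    neg-atom : ∀ {a} → Neg (atom a)
    neg-arr  : ∀ {P N} → Pos P → Neg N → Neg (arr P lu N)

mutual
  data Simple : Tm → Set where
    s-lam   : ∀ {x P M} → Pos P → Simple M → Simple (lam x lu P M)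
    s-spine : ∀ {M} → SimpleSpine M → Simple M

  data SimpleSpine : Tm → Set where
    sp-const : ∀ {c} → SimpleSpine (const c)
    sp-var   : ∀ {x} → SimpleSpine (var x)
    sp-app   : ∀ {M N} → SimpleSpine M → Simple N → SimpleSpine (app M l1 N)

-- Well-formedness of the contexts is required at the
-- leaves; since every rule's conclusion contexts are contained in the premise
-- contexts, every judgment in a derivation is then well-formed (in particular
-- the bound variable of an abstraction is fresh).
module Judgments (Σ : Sig) where
  mutual
    data _⨾_⨾_⊢_⇑_ : Ctx → Ctx → Ctx → Tm → Ty → Set where
      ⇑atm : ∀ {Γ Ω Δ M a} →
        Γ ⨾ Ω ⨾ Δ ⊢ M ↓ atom a →
        Γ ⨾ Ω ⨾ Δ ⊢ M ⇑ atom a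
      ⇑lam-u : ∀ {Γ Ω Δ x A M B} →
        ((x , A) ∷ Γ) ⨾ Ω ⨾ Δ ⊢ M ⇑ B →
        Γ ⨾ Ω ⨾ Δ ⊢ lam x lu A M ⇑ arr A lu B
      ⇑lam-0 : ∀ {Γ Ω Δ x A M B} →
        Γ ⨾ ((x , A) ∷ Ω) ⨾ Δ ⊢ M ⇑ B →
        Γ ⨾ Ω ⨾ Δ ⊢ lam x l0 A M ⇑ arr A l0 B
      ⇑lam-1 : ∀ {Γ Ω Δ x A M B} →
        Γ ⨾ Ω ⨾ ((x , A) ∷ Δ) ⊢ M ⇑ B →
        Γ ⨾ Ω ⨾ Δ ⊢ lam x l1 A M ⇑ arr A l1 B

    data _⨾_⨾_⊢_↓_ : Ctx → Ctx → Ctx → Tm → Ty → Set where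
      ↓const : ∀ {Γ Ω c A} →
        WF Γ Ω [] →
        (c , A) ∈ Σ →
        Γ ⨾ Ω ⨾ [] ⊢ const c ↓ A
      ↓var-u : ∀ {Γ Ω x A} →
        WF Γ Ω [] →
        (x , A) ∈ Γ →
        Γ ⨾ Ω ⨾ [] ⊢ var x ↓ A
      ↓var-1 : ∀ {Γ Ω x A} →
        WF Γ Ω ((x , A) ∷ []) →
        Γ ⨾ Ω ⨾ ((x , A) ∷ []) ⊢ var x ↓ A
      ↓app-u : ∀ {Γ Ω Δ M N A B} →
        Γ ⨾ Ω ⨾ Δ ⊢ M ↓ arr A lu B →
        (Γ ++ Δ) ⨾ Ω ⨾ [] ⊢ N ⇑ A →
        Γ ⨾ Ω ⨾ Δ ⊢ app M lu N ↓ B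
      ↓app-0 : ∀ {Γ Ω Δ M N A B} →
        Γ ⨾ Ω ⨾ Δ ⊢ M ↓ arr A l0 B →
        (Γ ++ Ω ++ Δ) ⨾ [] ⨾ [] ⊢ N ⇑ A →
        Γ ⨾ Ω ⨾ Δ ⊢ app M l0 N ↓ B
      ↓app-1 : ∀ {Γ Ω Δ ΔM ΔN M N A B} →
        Δ ↭ (ΔM ++ ΔN) →
        (Γ ++ ΔN) ⨾ Ω ⨾ ΔM ⊢ M ↓ arr A l1 B →
        (Γ ++ ΔM) ⨾ Ω ⨾ ΔN ⊢ N ⇑ A →
        Γ ⨾ Ω ⨾ Δ ⊢ app M l1 N ↓ B

{-# OPTIONS --safe #-}
-- Every application in a simple term is strict, so an unrestricted hypothesis
-- is used either strictly or not at all.  At a strict application M N it is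
-- given to the side that uses it strictly (preferring M) and returned to the
-- other side as an unrestricted hypothesis; this loses nothing, because strict
-- and irrelevant hypotheses can always be relaxed to unrestricted ones.
module Submission where

open import Defs
open import Data.Empty using (⊥-elim)
open import Data.Product using (_×_; _,_; proj₁; ∃-syntax)
open import Data.Sum using (_⊎_; inj₁; inj₂; map)
open import Data.List using ([]; _∷_; _++_; [_])
open import Data.List.Relation.Unary.Any using (here; there)
open import Data.List.Membership.Propositional.Properties using (∈-++⁻; ∈-∃++)
open import Data.List.Relation.Binary.Permutation.Propositional
open import Data.List.Relation.Binary.Permutation.Propositional.Properties
import Data.List.Relation.Binary.Permutation.Setoid.Properties as Setoid↭
open import Data.List.Relation.Unary.Unique.Propositional using (Unique)
open import Relation.Binary.PropositionalEquality using (refl; setoid)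

module _ {A : Set} where

  ++⁺ˡ-shift : ∀ xs {ys zs} (v : A) → ys ↭ v ∷ zs → xs ++ ys ↭ v ∷ xs ++ zs
  ++⁺ˡ-shift xs {zs = zs} v p = trans (++⁺ˡ xs p) (shift v xs zs)

  ∷↭++⁻ : ∀ {v : A} {xs ys zs} → v ∷ xs ↭ ys ++ zs →
    (∃[ ys′ ] ys ↭ v ∷ ys′ × xs ↭ ys′ ++ zs) ⊎ (∃[ zs′ ] zs ↭ v ∷ zs′ × xs ↭ ys ++ zs′)
  ∷↭++⁻ {v} {ys = ys} {zs} p with ∈-++⁻ ys (∈-resp-↭ p (here refl))
  ... | inj₁ v∈ys with us , ws , refl ← ∈-∃++ v∈ys =
    inj₁ (us ++ ws , shift v us ws , drop-∷ (trans p (++⁺ʳ zs (shift v us ws))))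
  ... | inj₂ v∈zs with us , ws , refl ← ∈-∃++ v∈zs =
    inj₂ (us ++ ws , shift v us ws , drop-∷ (trans p (++⁺ˡ-shift ys v (shift v us ws))))

Unique-dom-resp-↭ : ∀ {Γ Γ′ : Ctx} → Γ ↭ Γ′ → Unique (dom Γ) → Unique (dom Γ′)
Unique-dom-resp-↭ p = Setoid↭.Unique-resp-↭ (setoid Var) (↭⇒↭ₛ (map⁺ proj₁ p))

module _ (Σ : Sig) where
  open Judgments Σ

  mutual
    ↓-resp-↭ : ∀ {Γ Ω Δ Γ′ Ω′ Δ′ M A} → Γ ↭ Γ′ → Ω ↭ Ω′ → Δ ↭ Δ′ →
      Γ ⨾ Ω ⨾ Δ ⊢ M ↓ A → Γ′ ⨾ Ω′ ⨾ Δ′ ⊢ M ↓ A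
    ↓-resp-↭ g o s (↓const w c∈Σ) with refl ← ↭-empty-inv (↭-sym s) =
      ↓const (Unique-dom-resp-↭ (++⁺ g (++⁺ o s)) w) c∈Σ
    ↓-resp-↭ g o s (↓var-u w x∈Γ) with refl ← ↭-empty-inv (↭-sym s) =
      ↓var-u (Unique-dom-resp-↭ (++⁺ g (++⁺ o s)) w) (∈-resp-↭ g x∈Γ)
    ↓-resp-↭ g o s (↓var-1 w) with refl ← ↭-singleton-inv (↭-sym s) =
      ↓var-1 (Unique-dom-resp-↭ (++⁺ g (++⁺ o s)) w)
    ↓-resp-↭ g o s (↓app-u dM dN) =
      ↓app-u (↓-resp-↭ g o s dM) (⇑-resp-↭ (++⁺ g s) o refl dN)
    ↓-resp-↭ g o s (↓app-0 dM dN) =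
      ↓app-0 (↓-resp-↭ g o s dM) (⇑-resp-↭ (++⁺ g (++⁺ o s)) refl refl dN)
    ↓-resp-↭ g o s (↓app-1 {ΔM = ΔM} {ΔN} split dM dN) =
      ↓app-1 (trans (↭-sym s) split) (↓-resp-↭ (++⁺ʳ ΔN g) o refl dM) (⇑-resp-↭ (++⁺ʳ ΔM g) o refl dN)

    ⇑-resp-↭ : ∀ {Γ Ω Δ Γ′ Ω′ Δ′ M A} → Γ ↭ Γ′ → Ω ↭ Ω′ → Δ ↭ Δ′ →
      Γ ⨾ Ω ⨾ Δ ⊢ M ⇑ A → Γ′ ⨾ Ω′ ⨾ Δ′ ⊢ M ⇑ A
    ⇑-resp-↭ g o s (⇑atm d) = ⇑atm (↓-resp-↭ g o s d)
    ⇑-resp-↭ g o s (⇑lam-u d) = ⇑lam-u (⇑-resp-↭ (prep _ g) o s d)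
    ⇑-resp-↭ g o s (⇑lam-0 d) = ⇑lam-0 (⇑-resp-↭ g (prep _ o) s d)
    ⇑-resp-↭ g o s (⇑lam-1 d) = ⇑lam-1 (⇑-resp-↭ g o (prep _ s) d)

  ↓-resp-↭ᵘ : ∀ {Γ Γ′ Ω Δ M A} → Γ ↭ Γ′ → Γ ⨾ Ω ⨾ Δ ⊢ M ↓ A → Γ′ ⨾ Ω ⨾ Δ ⊢ M ↓ A
  ↓-resp-↭ᵘ g = ↓-resp-↭ g refl refl

  ⇑-resp-↭ᵘ : ∀ {Γ Γ′ Ω Δ M A} → Γ ↭ Γ′ → Γ ⨾ Ω ⨾ Δ ⊢ M ⇑ A → Γ′ ⨾ Ω ⨾ Δ ⊢ M ⇑ A
  ⇑-resp-↭ᵘ g = ⇑-resp-↭ g refl refl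

  -- The source context is only fixed up to permutation, so that the hypothesis
  -- can sit behind a newly bound variable or in either half of a context split;
  -- reordering the derivation instead would break the structural recursion.
  mutual
    ↓-strict⇒unrestricted : ∀ {Γ Ω Δ Δ′ M A v} → Δ ↭ v ∷ Δ′ →
      Γ ⨾ Ω ⨾ Δ ⊢ M ↓ A → (v ∷ Γ) ⨾ Ω ⨾ Δ′ ⊢ M ↓ A
    ↓-strict⇒unrestricted p (↓const _ _) = ⊥-elim (¬x∷xs↭[] (↭-sym p))
    ↓-strict⇒unrestricted p (↓var-u _ _) = ⊥-elim (¬x∷xs↭[] (↭-sym p))
    ↓-strict⇒unrestricted {Γ} {Ω} p (↓var-1 w) with refl ← ↭-singleton-inv (↭-sym p) =
      ↓var-u (Unique-dom-resp-↭ (++⁺ˡ-shift Γ _ (++⁺ˡ-shift Ω _ refl)) w) (here refl)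
    ↓-strict⇒unrestricted {Γ} p (↓app-u dM dN) =
      ↓app-u (↓-strict⇒unrestricted p dM) (⇑-resp-↭ᵘ (++⁺ˡ-shift Γ _ p) dN)
    ↓-strict⇒unrestricted {Γ} {Ω} p (↓app-0 dM dN) =
      ↓app-0 (↓-strict⇒unrestricted p dM) (⇑-resp-↭ᵘ (++⁺ˡ-shift Γ _ (++⁺ˡ-shift Ω _ p)) dN)
    ↓-strict⇒unrestricted {Γ} p (↓app-1 split dM dN) with ∷↭++⁻ (trans (↭-sym p) split)
    ... | inj₁ (_ , pM , split′) =
      ↓app-1 split′ (↓-strict⇒unrestricted pM dM) (⇑-resp-↭ᵘ (++⁺ˡ-shift Γ _ pM) dN)
    ... | inj₂ (_ , pN , split′) =
      ↓app-1 split′ (↓-resp-↭ᵘ (++⁺ˡ-shift Γ _ pN) dM) (⇑-strict⇒unrestricted pN dN)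

    ⇑-strict⇒unrestricted : ∀ {Γ Ω Δ Δ′ M A v} → Δ ↭ v ∷ Δ′ →
      Γ ⨾ Ω ⨾ Δ ⊢ M ⇑ A → (v ∷ Γ) ⨾ Ω ⨾ Δ′ ⊢ M ⇑ A
    ⇑-strict⇒unrestricted p (⇑atm d) = ⇑atm (↓-strict⇒unrestricted p d)
    ⇑-strict⇒unrestricted p (⇑lam-u d) = ⇑lam-u (⇑-resp-↭ᵘ (swap _ _ refl) (⇑-strict⇒unrestricted p d))
    ⇑-strict⇒unrestricted p (⇑lam-0 d) = ⇑lam-0 (⇑-strict⇒unrestricted p d)
    ⇑-strict⇒unrestricted p (⇑lam-1 d) = ⇑lam-1 (⇑-strict⇒unrestricted (++⁺ˡ-shift [ _ ] _ p) d)

  mutual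
    ↓-irrelevant⇒unrestricted : ∀ {Γ Ω Ω′ Δ M A v} → Ω ↭ v ∷ Ω′ →
      Γ ⨾ Ω ⨾ Δ ⊢ M ↓ A → (v ∷ Γ) ⨾ Ω′ ⨾ Δ ⊢ M ↓ A
    ↓-irrelevant⇒unrestricted {Γ} p (↓const w c∈Σ) =
      ↓const (Unique-dom-resp-↭ (++⁺ˡ-shift Γ _ (++⁺ʳ [] p)) w) c∈Σ
    ↓-irrelevant⇒unrestricted {Γ} p (↓var-u w x∈Γ) =
      ↓var-u (Unique-dom-resp-↭ (++⁺ˡ-shift Γ _ (++⁺ʳ [] p)) w) (there x∈Γ)
    ↓-irrelevant⇒unrestricted {Γ} p (↓var-1 w) =
      ↓var-1 (Unique-dom-resp-↭ (++⁺ˡ-shift Γ _ (++⁺ʳ _ p)) w)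
    ↓-irrelevant⇒unrestricted p (↓app-u dM dN) =
      ↓app-u (↓-irrelevant⇒unrestricted p dM) (⇑-irrelevant⇒unrestricted p dN)
    ↓-irrelevant⇒unrestricted {Γ} {Δ = Δ} p (↓app-0 dM dN) =
      ↓app-0 (↓-irrelevant⇒unrestricted p dM) (⇑-resp-↭ᵘ (++⁺ˡ-shift Γ _ (++⁺ʳ Δ p)) dN)
    ↓-irrelevant⇒unrestricted p (↓app-1 split dM dN) =
      ↓app-1 split (↓-irrelevant⇒unrestricted p dM) (⇑-irrelevant⇒unrestricted p dN)

    ⇑-irrelevant⇒unrestricted : ∀ {Γ Ω Ω′ Δ M A v} → Ω ↭ v ∷ Ω′ →
      Γ ⨾ Ω ⨾ Δ ⊢ M ⇑ A → (v ∷ Γ) ⨾ Ω′ ⨾ Δ ⊢ M ⇑ A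
    ⇑-irrelevant⇒unrestricted p (⇑atm d) = ⇑atm (↓-irrelevant⇒unrestricted p d)
    ⇑-irrelevant⇒unrestricted p (⇑lam-u d) = ⇑lam-u (⇑-resp-↭ᵘ (swap _ _ refl) (⇑-irrelevant⇒unrestricted p d))
    ⇑-irrelevant⇒unrestricted p (⇑lam-0 d) = ⇑lam-0 (⇑-irrelevant⇒unrestricted (++⁺ˡ-shift [ _ ] _ p) d)
    ⇑-irrelevant⇒unrestricted p (⇑lam-1 d) = ⇑lam-1 (⇑-irrelevant⇒unrestricted p d)

  ⇑-strict⊎irrelevant⇒unrestricted : ∀ {Γ Ω Δ M A v} →
    (Γ ⨾ Ω ⨾ (v ∷ Δ) ⊢ M ⇑ A) ⊎ (Γ ⨾ (v ∷ Ω) ⨾ Δ ⊢ M ⇑ A) → (v ∷ Γ) ⨾ Ω ⨾ Δ ⊢ M ⇑ A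
  ⇑-strict⊎irrelevant⇒unrestricted (inj₁ d) = ⇑-strict⇒unrestricted refl d
  ⇑-strict⊎irrelevant⇒unrestricted (inj₂ d) = ⇑-irrelevant⇒unrestricted refl d

  mutual
    spine-unrestricted⇒strict⊎irrelevant : ∀ {Γ Ω Δ M A v} → SimpleSpine M →
      (v ∷ Γ) ⨾ Ω ⨾ Δ ⊢ M ↓ A → (Γ ⨾ Ω ⨾ (v ∷ Δ) ⊢ M ↓ A) ⊎ (Γ ⨾ (v ∷ Ω) ⨾ Δ ⊢ M ↓ A)
    spine-unrestricted⇒strict⊎irrelevant {Γ} {Ω} {Δ} {v = v} sp-const (↓const w c∈Σ) =
      inj₂ (↓const (Unique-dom-resp-↭ (↭-sym (shift v Γ (Ω ++ Δ))) w) c∈Σ)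
    spine-unrestricted⇒strict⊎irrelevant {Γ} {Ω} sp-var (↓var-u w (here refl)) =
      inj₁ (↓var-1 (Unique-dom-resp-↭ (↭-sym (++⁺ˡ-shift Γ _ (++⁺ˡ-shift Ω _ refl))) w))
    spine-unrestricted⇒strict⊎irrelevant {Γ} {Ω} {Δ} {v = v} sp-var (↓var-u w (there x∈Γ)) =
      inj₂ (↓var-u (Unique-dom-resp-↭ (↭-sym (shift v Γ (Ω ++ Δ))) w) x∈Γ)
    spine-unrestricted⇒strict⊎irrelevant {Γ} {Ω} {Δ} {v = v} sp-var (↓var-1 w) =
      inj₂ (↓var-1 (Unique-dom-resp-↭ (↭-sym (shift v Γ (Ω ++ Δ))) w))
    spine-unrestricted⇒strict⊎irrelevant {Γ} {v = v} (sp-app sM sN) (↓app-1 {ΔM = ΔM} {ΔN} split dM dN)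
      with spine-unrestricted⇒strict⊎irrelevant sM dM
    ... | inj₁ dM′ =
      inj₁ (↓app-1 (prep v split) dM′
        (⇑-resp-↭ᵘ (↭-sym (shift v Γ ΔM))
          (⇑-strict⊎irrelevant⇒unrestricted (⇑-unrestricted⇒strict⊎irrelevant sN dN))))
    ... | inj₂ dM′ with ⇑-unrestricted⇒strict⊎irrelevant sN dN
    ...   | inj₁ dN′ =
      inj₁ (↓app-1 (trans (prep v split) (↭-sym (shift v ΔM ΔN)))
        (↓-resp-↭ᵘ (↭-sym (shift v Γ ΔN)) (↓-irrelevant⇒unrestricted refl dM′)) dN′)
    ...   | inj₂ dN′ = inj₂ (↓app-1 split dM′ dN′)

    ⇑-unrestricted⇒strict⊎irrelevant : ∀ {Γ Ω Δ M A v} → Simple M →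
      (v ∷ Γ) ⨾ Ω ⨾ Δ ⊢ M ⇑ A → (Γ ⨾ Ω ⨾ (v ∷ Δ) ⊢ M ⇑ A) ⊎ (Γ ⨾ (v ∷ Ω) ⨾ Δ ⊢ M ⇑ A)
    ⇑-unrestricted⇒strict⊎irrelevant (s-lam _ sM) (⇑lam-u d) =
      map ⇑lam-u ⇑lam-u (⇑-unrestricted⇒strict⊎irrelevant sM (⇑-resp-↭ᵘ (swap _ _ refl) d))
    ⇑-unrestricted⇒strict⊎irrelevant (s-spine sp) (⇑atm d) =
      map ⇑atm ⇑atm (spine-unrestricted⇒strict⊎irrelevant sp d)
    ⇑-unrestricted⇒strict⊎irrelevant (s-spine ()) (⇑lam-u _)
    ⇑-unrestricted⇒strict⊎irrelevant (s-spine ()) (⇑lam-0 _)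
    ⇑-unrestricted⇒strict⊎irrelevant (s-spine ()) (⇑lam-1 _)

  ↓-unrestricted⇒strict⊎irrelevant : ∀ {Γ Ω Δ M A v} → Simple M →
    (v ∷ Γ) ⨾ Ω ⨾ Δ ⊢ M ↓ A → (Γ ⨾ Ω ⨾ (v ∷ Δ) ⊢ M ↓ A) ⊎ (Γ ⨾ (v ∷ Ω) ⨾ Δ ⊢ M ↓ A)
  ↓-unrestricted⇒strict⊎irrelevant (s-spine sp) d = spine-unrestricted⇒strict⊎irrelevant sp d

lemma5p5 : (Σ : Sig) → let open Judgments Σ in
    ∀ {Γ Ω Δ : Ctx} {x : Var} {C A : Ty} {M : Tm} → Simple M →
      ((((x , C) ∷ Γ) ⨾ Ω ⨾ Δ ⊢ M ↓ A) →
        ((Γ ⨾ Ω ⨾ ((x , C) ∷ Δ) ⊢ M ↓ A) ⊎ (Γ ⨾ ((x , C) ∷ Ω) ⨾ Δ ⊢ M ↓ A)))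
      × ((((x , C) ∷ Γ) ⨾ Ω ⨾ Δ ⊢ M ⇑ A) →
        ((Γ ⨾ Ω ⨾ ((x , C) ∷ Δ) ⊢ M ⇑ A) ⊎ (Γ ⨾ ((x , C) ∷ Ω) ⨾ Δ ⊢ M ⇑ A)))
lemma5p5 Σ sM = ↓-unrestricted⇒strict⊎irrelevant Σ sM , ⇑-unrestricted⇒strict⊎irrelevant Σ sM
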